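{- Let $s\ge 1$, $L\ge 2s^3+5s^2+1$, $L\le k\le s+L$ and $n\ge 2s^5+8s^4+s^3-14s^2+3s+1$ be integers, and write $k=rs+t$ with integers $r$ and $0\le t\le s-1$. There is an injection $\phi_4:C^4_{L,s,2}(n)\to F^4_{L,s,k}(n)$.
   Context: $C_{L,s,2}(n)$ is the set of partitions of $n$ with all parts in $\{s+1,\ldots,s+L\}$; for such a partition, $f_i$ denotes the number of parts equal to $i$. $F_{L,s,k}(n)$ is the set of partitions of $n$ with smallest part equal to $s$, largest part at most $s+L$, and no part equal to $k$; for such a partition, $g_i$ denotes the number of parts equal to $i$. $C^4_{L,s,2}(n)$ is the set of partitions in $C_{L,s,2}(n)$ with $f_k\ge 2$. $F^4_{L,s,k}(n)$ is the set of partitions in $F_{L,s,k}(n)$ with $g_s\ge 2r-4$. -}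

module Defs where

open import Data.Nat using (ℕ; _+_; _*_; _∸_; _≤_; _<_; _≥_; _≟_)
open import Data.List using (List; length; filter)
open import Data.Nat.ListAction using (sum)
open import Data.List.Relation.Unary.All using (All)
open import Data.List.Relation.Unary.Linked using (Linked)
open import Data.List.Membership.Propositional using (_∈_)
open import Data.Product using (Σ; _×_; proj₁)
open import Relation.Binary.PropositionalEquality using (_≡_)

IsPartition : ℕ → List ℕ → Set
IsPartition n ps = Linked _≥_ ps × All (λ p → 1 ≤ p) ps × sum ps ≡ n

mult : ℕ → List ℕ → ℕ
mult i ps = length (filter (λ p → p ≟ i) ps)

InC : ℕ → ℕ → ℕ → List ℕ → Set
InC L s n ps = IsPartition n ps × All (λ p → s + 1 ≤ p × p ≤ s + L) ps

InC4 : ℕ → ℕ → ℕ → ℕ → List ℕ → Set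
InC4 L s k n ps = InC L s n ps × 2 ≤ mult k ps

InF : ℕ → ℕ → ℕ → ℕ → List ℕ → Set
InF L s k n ps =
  IsPartition n ps × s ∈ ps × All (λ p → s ≤ p × p ≤ s + L) ps × mult k ps ≡ 0

-- F^4_{L,s,k}(n): those with g_s ≥ 2r-4 (as integers; since g_s ≥ 0 this is
-- equivalent to the truncated-subtraction inequality below)
InF4 : ℕ → ℕ → ℕ → ℕ → ℕ → List ℕ → Set
InF4 L s k r n ps = InF L s k n ps × (2 * r) ∸ 4 ≤ mult s ps

C4 : ℕ → ℕ → ℕ → ℕ → Set
C4 L s k n = Σ (List ℕ) (InC4 L s k n)

F4 : ℕ → ℕ → ℕ → ℕ → ℕ → Set
F4 L s k r n = Σ (List ℕ) (InF4 L s k r n)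

InjectivePartitionMap : {A B : List ℕ → Set} →
  (Σ (List ℕ) A → Σ (List ℕ) B) → Set
InjectivePartitionMap φ = ∀ x y → proj₁ (φ x) ≡ proj₁ (φ y) → proj₁ x ≡ proj₁ y

module Submission where

-- A partition in C⁴ has f = f_k ≥ 2 parts equal to k and no part equal
-- to s.  We replace its f parts equal to k, of total f·k, by a parts
-- equal to s and one part b in the window s < b ≤ 2s, where
-- f·k = a·s + b is the "window division" of f·k by s, and sort.  The
-- image has smallest part s, no part k (as b ≤ 2s < k) and at least
-- 2r - 4 parts s, because 2rs ≤ 2k ≤ fk ≤ (a + 2)s.  The map is
-- injective: a is the multiplicity of s in the image, and then f and b
-- are determined since two multiples of k > 2s cannot lie in the same
-- window a·s + [0, 2s]; the remaining parts are untouched.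

open import Defs
open import Data.Nat using (ℕ; zero; suc; _+_; _*_; _∸_; _≤_; _<_; _≥_; _≟_; NonZero; >-nonZero; z≤n; s≤s; s≤s⁻¹; _/_; _%_)
open import Data.Nat.Properties
open import Data.Nat.DivMod using (m≡m%n+[m/n]*n; m%n<n; m≥n⇒m/n>0)
open import Data.Nat.ListAction using (sum)
open import Data.Nat.ListAction.Properties using (sum-↭; sum-++)
open import Data.Nat.Solver using (module +-*-Solver)
open import Algebra.Properties.CommutativeSemigroup +-commutativeSemigroup using (x∙yz≈y∙xz)
open import Data.List using (List; []; _∷_; _++_; length; filter; replicate)
open import Data.List.Properties
  using (filter-++; length-++; filter-accept; filter-reject; filter-none; filter-all; length-replicate)
open import Data.List.Relation.Unary.All as All using (All; []; _∷_)
import Data.List.Relation.Unary.All.Properties as AllP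
open import Data.List.Relation.Unary.Any using (here; there)
open import Data.List.Relation.Unary.Linked using (Linked)
import Data.List.Relation.Unary.Linked as Linked
open import Data.List.Relation.Unary.Linked.Properties using (Linked⇒All)
open import Data.List.Membership.Propositional using (_∈_)
open import Data.List.Relation.Binary.Permutation.Propositional using (_↭_; ↭-sym)
open import Data.List.Relation.Binary.Permutation.Propositional.Properties
  using (filter-↭; ↭-length; All-resp-↭; ∈-resp-↭)
import Data.List.Sort as Sort
open import Data.Product using (Σ; _×_; _,_; proj₂)
open import Data.Empty using (⊥-elim)
open import Function using (_∘_)
open import Relation.Nullary using (yes; no; ¬?)
open import Relation.Binary.Definitions using (tri<; tri≈; tri>)
open import Relation.Binary.PropositionalEquality
  using (_≡_; _≢_; refl; sym; trans; cong; cong₂; module ≡-Reasoning)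
open import Relation.Binary.Construct.Flip.EqAndOrd as Flip using ()

open Sort (Flip.decTotalOrder ≤-decTotalOrder) using (sort; sort-↭; sort-↗)

mult-++ : ∀ j xs ys → mult j (xs ++ ys) ≡ mult j xs + mult j ys
mult-++ j xs ys = trans (cong length (filter-++ (_≟ j) xs ys)) (length-++ (filter (_≟ j) xs))

mult-head : ∀ j xs → mult j (j ∷ xs) ≡ suc (mult j xs)
mult-head j xs = cong length (filter-accept (_≟ j) refl)

mult-skip : ∀ {j x} xs → x ≢ j → mult j (x ∷ xs) ≡ mult j xs
mult-skip {j} xs x≢j = cong length (filter-reject (_≟ j) x≢j)

mult-absent : ∀ {j xs} → All (_≢ j) xs → mult j xs ≡ 0
mult-absent {j} none = cong length (filter-none (_≟ j) none)

mult-replicate : ∀ a j → mult j (replicate a j) ≡ a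
mult-replicate a j = trans (cong length (filter-all (_≟ j) (AllP.replicate⁺ a refl))) (length-replicate a)

mult-↭ : ∀ j {xs ys} → xs ↭ ys → mult j xs ≡ mult j ys
mult-↭ j xs↭ys = ↭-length (filter-↭ (_≟ j) xs↭ys)

removeAll : ℕ → List ℕ → List ℕ
removeAll k = filter (λ p → ¬? (p ≟ k))

removeAll-keep : ∀ {k x} xs → x ≢ k → removeAll k (x ∷ xs) ≡ x ∷ removeAll k xs
removeAll-keep {k} xs x≢k = filter-accept (λ p → ¬? (p ≟ k)) x≢k

removeAll-drop : ∀ {k} xs → removeAll k (k ∷ xs) ≡ removeAll k xs
removeAll-drop {k} xs = filter-reject (λ p → ¬? (p ≟ k)) (λ k≢k → k≢k refl)

mult-removeAll-self : ∀ k xs → mult k (removeAll k xs) ≡ 0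
mult-removeAll-self k xs = mult-absent (AllP.all-filter (λ p → ¬? (p ≟ k)) xs)

mult-removeAll-other : ∀ {j k} xs → j ≢ k → mult j (removeAll k xs) ≡ mult j xs
mult-removeAll-other [] _ = refl
mult-removeAll-other {j} {k} (x ∷ xs) j≢k with x ≟ k | x ≟ j
... | yes refl | _ = begin
  mult j (removeAll x (x ∷ xs)) ≡⟨ cong (mult j) (removeAll-drop xs) ⟩
  mult j (removeAll x xs)       ≡⟨ mult-removeAll-other xs j≢k ⟩
  mult j xs                     ≡⟨ mult-skip xs (j≢k ∘ sym) ⟨
  mult j (x ∷ xs)               ∎
  where open ≡-Reasoning
... | no x≢k | yes refl = begin
  mult x (removeAll k (x ∷ xs)) ≡⟨ cong (mult x) (removeAll-keep xs x≢k) ⟩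
  mult x (x ∷ removeAll k xs)   ≡⟨ mult-head x (removeAll k xs) ⟩
  suc (mult x (removeAll k xs)) ≡⟨ cong suc (mult-removeAll-other xs j≢k) ⟩
  suc (mult x xs)               ≡⟨ mult-head x xs ⟨
  mult x (x ∷ xs)               ∎
  where open ≡-Reasoning
... | no x≢k | no x≢j = begin
  mult j (removeAll k (x ∷ xs)) ≡⟨ cong (mult j) (removeAll-keep xs x≢k) ⟩
  mult j (x ∷ removeAll k xs)   ≡⟨ mult-skip (removeAll k xs) x≢j ⟩
  mult j (removeAll k xs)       ≡⟨ mult-removeAll-other xs j≢k ⟩
  mult j xs                     ≡⟨ mult-skip xs x≢j ⟨
  mult j (x ∷ xs)               ∎
  where open ≡-Reasoning

sum-removeAll : ∀ k xs → sum xs ≡ mult k xs * k + sum (removeAll k xs)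
sum-removeAll k [] = refl
sum-removeAll k (x ∷ xs) with x ≟ k
... | yes refl = begin
  x + sum xs                                 ≡⟨ cong (x +_) (sum-removeAll x xs) ⟩
  x + (mult x xs * x + sum (removeAll x xs)) ≡⟨ +-assoc x _ _ ⟨
  suc (mult x xs) * x + sum (removeAll x xs) ≡⟨ cong₂ (λ m r → m * x + sum r) (mult-head x xs) (removeAll-drop xs) ⟨
  mult x (x ∷ xs) * x + sum (removeAll x (x ∷ xs)) ∎
  where open ≡-Reasoning
... | no x≢k = begin
  x + sum xs                                 ≡⟨ cong (x +_) (sum-removeAll k xs) ⟩
  x + (mult k xs * k + sum (removeAll k xs)) ≡⟨ x∙yz≈y∙xz x (mult k xs * k) (sum (removeAll k xs)) ⟩
  mult k xs * k + (x + sum (removeAll k xs)) ≡⟨ cong₂ (λ m r → m * k + sum r) (mult-skip xs x≢k) (removeAll-keep xs x≢k) ⟨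
  mult k (x ∷ xs) * k + sum (removeAll k (x ∷ xs)) ∎
  where open ≡-Reasoning

sum-replicate : ∀ a x → sum (replicate a x) ≡ a * x
sum-replicate zero x = refl
sum-replicate (suc a) x = cong (x +_) (sum-replicate a x)

mult-above-head : ∀ {x y} xs → x < y → Linked _≥_ (x ∷ xs) → mult y (x ∷ xs) ≡ 0
mult-above-head xs x<y sorted =
  mult-absent (All.map (λ p≤x p≡y → <⇒≢ (≤-<-trans p≤x x<y) p≡y)
                       (Linked⇒All (λ y≥x z≥y → ≤-trans z≥y y≥x) ≤-refl sorted))

sorted-mult-unique : ∀ xs ys → Linked _≥_ xs → Linked _≥_ ys →
  (∀ j → mult j xs ≡ mult j ys) → xs ≡ ys
sorted-mult-unique [] [] _ _ _ = refl
sorted-mult-unique [] (y ∷ ys) _ _ same = ⊥-elim (0≢1+n (trans (same y) (mult-head y ys)))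
sorted-mult-unique (x ∷ xs) [] _ _ same = ⊥-elim (0≢1+n (trans (sym (same x)) (mult-head x xs)))
sorted-mult-unique (x ∷ xs) (y ∷ ys) sx sy same with <-cmp x y
... | tri< x<y _ _ = ⊥-elim (0≢1+n (begin
  0                 ≡⟨ mult-above-head xs x<y sx ⟨
  mult y (x ∷ xs)   ≡⟨ same y ⟩
  mult y (y ∷ ys)   ≡⟨ mult-head y ys ⟩
  suc (mult y ys)   ∎))
  where open ≡-Reasoning
... | tri> _ _ y<x = ⊥-elim (0≢1+n (begin
  0                 ≡⟨ mult-above-head ys y<x sy ⟨
  mult x (y ∷ ys)   ≡⟨ same x ⟨
  mult x (x ∷ xs)   ≡⟨ mult-head x xs ⟩
  suc (mult x xs)   ∎))
  where open ≡-Reasoning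
... | tri≈ _ refl _ = cong (x ∷_) (sorted-mult-unique xs ys (Linked.tail sx) (Linked.tail sy) same-tail)
  where
  same-tail : ∀ j → mult j xs ≡ mult j ys
  same-tail j = +-cancelˡ-≡ (mult j (x ∷ [])) _ _
    (trans (sym (mult-++ j (x ∷ []) xs)) (trans (same j) (mult-++ j (x ∷ []) ys)))

record Window (s m : ℕ) : Set where
  field
    quot rem  : ℕ
    split     : m ≡ quot * s + rem
    rem-lower : s < rem
    rem-upper : rem ≤ s + s

-- Every m > s admits a window division: from m - 1 = ρ + (a + 1)s with
-- ρ < s we get m = a·s + (s + ρ + 1).
window : ∀ s .{{_ : NonZero s}} m → s < m → Window s m
window s (suc m) s<m with m / s | m≥n⇒m/n>0 {m} {s} (s≤s⁻¹ s<m) | m≡m%n+[m/n]*n m s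
... | suc a | _ | m≡ρ+[a+1]s = record
  { quot = a
  ; rem = s + suc (m % s)
  ; split = begin
      suc m                        ≡⟨ cong suc m≡ρ+[a+1]s ⟩
      suc (m % s + suc a * s)      ≡⟨ solve 3 (λ ρ s as → con 1 :+ (ρ :+ (s :+ as)) := as :+ (s :+ (con 1 :+ ρ))) refl (m % s) s (a * s) ⟩
      a * s + (s + suc (m % s))    ∎
  ; rem-lower = m<m+n s 0<1+n
  ; rem-upper = +-monoʳ-≤ s (m%n<n m s)
  }
  where open ≡-Reasoning
        open +-*-Solver

-- Two multiples of k > 2s cannot lie in one window a·s + [0, 2s]:
-- if f₁ < f₂ then f₂k ≥ f₁k + k forces the second remainder to be ≥ k.
window-gap : ∀ {s k f₁ f₂} → f₁ < f₂ → (w₁ : Window s (f₁ * k)) (w₂ : Window s (f₂ * k)) →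
  Window.quot w₁ ≡ Window.quot w₂ → k ≤ Window.rem w₂
window-gap {s} {k} {f₁} {f₂} f₁<f₂ w₁ w₂ same-quot =
  ≤-trans (m≤m+n k b₁) (+-cancelˡ-≤ (a * s) (k + b₁) b₂ (begin
    a * s + (k + b₁)       ≡⟨ x∙yz≈y∙xz (a * s) k b₁ ⟩
    k + (a * s + b₁)       ≡⟨ cong (λ q → k + (q * s + b₁)) same-quot ⟨
    k + (W₁.quot * s + b₁) ≡⟨ cong (k +_) W₁.split ⟨
    k + f₁ * k             ≤⟨ *-monoˡ-≤ k f₁<f₂ ⟩
    f₂ * k                 ≡⟨ W₂.split ⟩
    a * s + b₂             ∎))
  where
  module W₁ = Window w₁
  module W₂ = Window w₂
  a = W₂.quot
  b₂ = W₂.rem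
  b₁ = W₁.rem
  open ≤-Reasoning

window-multiple-unique : ∀ {s k} f₁ f₂ → s + s < k →
  (w₁ : Window s (f₁ * k)) (w₂ : Window s (f₂ * k)) →
  Window.quot w₁ ≡ Window.quot w₂ → f₁ ≡ f₂
window-multiple-unique f₁ f₂ 2s<k w₁ w₂ same-quot with <-cmp f₁ f₂
... | tri< f₁<f₂ _ _ = ⊥-elim (<⇒≱ 2s<k (≤-trans (window-gap f₁<f₂ w₁ w₂ same-quot) (Window.rem-upper w₂)))
... | tri≈ _ f₁≡f₂ _ = f₁≡f₂
... | tri> _ _ f₂<f₁ = ⊥-elim (<⇒≱ 2s<k (≤-trans (window-gap f₂<f₁ w₂ w₁ (sym same-quot)) (Window.rem-upper w₁)))

module Replacement (s k : ℕ) (2s<k : s + s < k) where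

  s<k : s < k
  s<k = ≤-<-trans (m≤m+n s s) 2s<k

  newParts : ∀ {m} → Window s m → List ℕ
  newParts w = Window.rem w ∷ replicate (Window.quot w) s

  replaceK : (ps : List ℕ) → Window s (mult k ps * k) → List ℕ
  replaceK ps w = newParts w ++ removeAll k ps

  module _ (ps : List ℕ) (w : Window s (mult k ps * k)) where
    open Window w

    sum-replaceK : sum (replaceK ps w) ≡ sum ps
    sum-replaceK = begin
      rem + sum (replicate quot s ++ R)     ≡⟨ cong (rem +_) (sum-++ (replicate quot s) R) ⟩
      rem + (sum (replicate quot s) + sum R) ≡⟨ cong (λ x → rem + (x + sum R)) (sum-replicate quot s) ⟩
      rem + (quot * s + sum R)              ≡⟨ +-assoc rem _ _ ⟨
      rem + quot * s + sum R                ≡⟨ cong (_+ sum R) (+-comm rem (quot * s)) ⟩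
      quot * s + rem + sum R                ≡⟨ cong (_+ sum R) split ⟨
      mult k ps * k + sum R                 ≡⟨ sum-removeAll k ps ⟨
      sum ps                                ∎
      where open ≡-Reasoning
            R = removeAll k ps

    mult-k-replaceK : mult k (replaceK ps w) ≡ 0
    mult-k-replaceK = begin
      mult k (replaceK ps w)                                   ≡⟨ mult-skip _ (<⇒≢ (≤-<-trans rem-upper 2s<k)) ⟩
      mult k (replicate quot s ++ removeAll k ps)              ≡⟨ mult-++ k (replicate quot s) (removeAll k ps) ⟩
      mult k (replicate quot s) + mult k (removeAll k ps)      ≡⟨ cong₂ _+_ (mult-absent (AllP.replicate⁺ quot (<⇒≢ s<k))) (mult-removeAll-self k ps) ⟩
      0                                                        ∎
      where open ≡-Reasoning

    mult-s-replaceK : mult s ps ≡ 0 → mult s (replaceK ps w) ≡ quot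
    mult-s-replaceK no-s = begin
      mult s (replaceK ps w)                                   ≡⟨ mult-skip _ (>⇒≢ rem-lower) ⟩
      mult s (replicate quot s ++ removeAll k ps)              ≡⟨ mult-++ s (replicate quot s) (removeAll k ps) ⟩
      mult s (replicate quot s) + mult s (removeAll k ps)      ≡⟨ cong₂ _+_ (mult-replicate quot s) (trans (mult-removeAll-other ps (<⇒≢ s<k)) no-s) ⟩
      quot + 0                                                 ≡⟨ +-identityʳ quot ⟩
      quot                                                     ∎
      where open ≡-Reasoning

    -- Since f·k ≥ k > 2s ≥ rem whenever f ≥ 1, the quotient is positive.
    quot-positive : 1 ≤ mult k ps → 1 ≤ quot
    quot-positive f≥1 with quot | split
    ... | suc _ | _ = s≤s z≤n
    ... | zero | fk≡rem = ⊥-elim (<⇒≱ 2s<k (begin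
      k              ≤⟨ m≤n*m k (mult k ps) {{>-nonZero f≥1}} ⟩
      mult k ps * k  ≡⟨ fk≡rem ⟩
      rem            ≤⟨ rem-upper ⟩
      s + s          ∎))
      where open ≤-Reasoning

    s∈replaceK : 1 ≤ mult k ps → s ∈ replaceK ps w
    s∈replaceK f≥1 with quot | quot-positive f≥1
    ... | suc _ | _ = there (here refl)

    quot-lower : ∀ r .{{_ : NonZero s}} → r * s ≤ k → 2 ≤ mult k ps → 2 * r ∸ 4 ≤ quot
    quot-lower r rs≤k f≥2 = ≤-trans (∸-monoʳ-≤ (2 * r) (s≤s (s≤s z≤n)))
      (m≤n+o⇒m∸n≤o (2 * r) 2 (*-cancelʳ-≤ (2 * r) (2 + quot) s (begin
        2 * r * s          ≡⟨ *-assoc 2 r s ⟩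
        2 * (r * s)        ≤⟨ *-monoʳ-≤ 2 rs≤k ⟩
        2 * k              ≤⟨ *-monoˡ-≤ k f≥2 ⟩
        mult k ps * k      ≡⟨ split ⟩
        quot * s + rem     ≤⟨ +-monoʳ-≤ (quot * s) rem-upper ⟩
        quot * s + (s + s) ≡⟨ solve 2 (λ a s → a :* s :+ (s :+ s) := (con 2 :+ a) :* s) refl quot s ⟩
        (2 + quot) * s     ∎)))
      where open ≤-Reasoning
            open +-*-Solver

    replaceK-bounds : ∀ L → s ≤ L → All (λ p → s + 1 ≤ p × p ≤ s + L) ps →
      All (λ p → s ≤ p × p ≤ s + L) (replaceK ps w)
    replaceK-bounds L s≤L bounds =
      (<⇒≤ rem-lower , ≤-trans rem-upper (+-monoʳ-≤ s s≤L)) ∷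
      AllP.++⁺ (AllP.replicate⁺ quot (≤-refl , m≤m+n s L))
               (AllP.filter⁺ _ (All.map (λ (s+1≤p , p≤s+L) → ≤-trans (m≤m+n s 1) s+1≤p , p≤s+L) bounds))

  -- The replacement can be undone on multiplicities: the multiplicity of s
  -- gives the quotient, window uniqueness gives f_k and the remainder,
  -- and the other parts were left alone.
  replaceK-reflects-mult : ∀ ps₁ ps₂ (w₁ : Window s (mult k ps₁ * k)) (w₂ : Window s (mult k ps₂ * k)) →
    mult s ps₁ ≡ 0 → mult s ps₂ ≡ 0 →
    (∀ j → mult j (replaceK ps₁ w₁) ≡ mult j (replaceK ps₂ w₂)) → ∀ j → mult j ps₁ ≡ mult j ps₂
  replaceK-reflects-mult ps₁ ps₂ w₁ w₂ no-s₁ no-s₂ same = same-mult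
    where
    module W₁ = Window w₁
    module W₂ = Window w₂

    same-quot : W₁.quot ≡ W₂.quot
    same-quot = trans (sym (mult-s-replaceK ps₁ w₁ no-s₁)) (trans (same s) (mult-s-replaceK ps₂ w₂ no-s₂))

    same-f : mult k ps₁ ≡ mult k ps₂
    same-f = window-multiple-unique (mult k ps₁) (mult k ps₂) 2s<k w₁ w₂ same-quot

    same-rem : W₁.rem ≡ W₂.rem
    same-rem = +-cancelˡ-≡ (W₂.quot * s) W₁.rem W₂.rem (begin
      W₂.quot * s + W₁.rem ≡⟨ cong (λ q → q * s + W₁.rem) same-quot ⟨
      W₁.quot * s + W₁.rem ≡⟨ W₁.split ⟨
      mult k ps₁ * k       ≡⟨ cong (_* k) same-f ⟩
      mult k ps₂ * k       ≡⟨ W₂.split ⟩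
      W₂.quot * s + W₂.rem ∎)
      where open ≡-Reasoning

    same-newParts : newParts w₁ ≡ newParts w₂
    same-newParts = cong₂ (λ b a → b ∷ replicate a s) same-rem same-quot

    same-rest : ∀ j → mult j (removeAll k ps₁) ≡ mult j (removeAll k ps₂)
    same-rest j = +-cancelˡ-≡ (mult j (newParts w₂)) _ _ (begin
      mult j (newParts w₂) + mult j (removeAll k ps₁) ≡⟨ cong (λ xs → mult j xs + mult j (removeAll k ps₁)) same-newParts ⟨
      mult j (newParts w₁) + mult j (removeAll k ps₁) ≡⟨ mult-++ j (newParts w₁) (removeAll k ps₁) ⟨
      mult j (replaceK ps₁ w₁)                        ≡⟨ same j ⟩
      mult j (replaceK ps₂ w₂)                        ≡⟨ mult-++ j (newParts w₂) (removeAll k ps₂) ⟩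
      mult j (newParts w₂) + mult j (removeAll k ps₂) ∎)
      where open ≡-Reasoning

    same-mult : ∀ j → mult j ps₁ ≡ mult j ps₂
    same-mult j with j ≟ k
    ... | yes refl = same-f
    ... | no j≢k = trans (sym (mult-removeAll-other ps₁ j≢k)) (trans (same-rest j) (mult-removeAll-other ps₂ j≢k))

module Injection (L s k r : ℕ) (s≥1 : 1 ≤ s) (2s<L : s + s < L) (L≤k : L ≤ k) (rs≤k : r * s ≤ k) where

  instance
    s-nonZero : NonZero s
    s-nonZero = >-nonZero s≥1

  2s<k : s + s < k
  2s<k = <-≤-trans 2s<L L≤k

  open Replacement s k 2s<k

  no-part-s : ∀ {ps} → All (λ p → s + 1 ≤ p × p ≤ s + L) ps → mult s ps ≡ 0
  no-part-s = mult-absent ∘ All.map (λ (s+1≤p , _) → >⇒≢ (≤-trans (≤-reflexive (+-comm 1 s)) s+1≤p))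

  windowOf : (ps : List ℕ) → 2 ≤ mult k ps → Window s (mult k ps * k)
  windowOf ps f≥2 = window s (mult k ps * k)
    (<-≤-trans s<k (m≤n*m k (mult k ps) {{>-nonZero (≤-trans (s≤s z≤n) f≥2)}}))

  image : (ps : List ℕ) → 2 ≤ mult k ps → List ℕ
  image ps f≥2 = sort (replaceK ps (windowOf ps f≥2))

  mult-image : ∀ ps f≥2 j → mult j (image ps f≥2) ≡ mult j (replaceK ps (windowOf ps f≥2))
  mult-image ps f≥2 j = mult-↭ j (sort-↭ (replaceK ps (windowOf ps f≥2)))

  image-in-F4 : ∀ {n ps} (c : InC4 L s k n ps) → InF4 L s k r n (image ps (proj₂ c))
  image-in-F4 {n} {ps} (((_ , _ , sum≡n) , bounds) , f≥2) =
    ((sort-↗ qs , image-positive , image-sum) , s∈image , image-bounds , no-k) , many-s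
    where
    w = windowOf ps f≥2
    qs = replaceK ps w

    image-bounds : All (λ p → s ≤ p × p ≤ s + L) (image ps f≥2)
    image-bounds = All-resp-↭ (↭-sym (sort-↭ qs))
      (replaceK-bounds ps w L (≤-trans (m≤m+n s s) (<⇒≤ 2s<L)) bounds)

    image-positive : All (λ p → 1 ≤ p) (image ps f≥2)
    image-positive = All.map (λ (s≤p , _) → ≤-trans s≥1 s≤p) image-bounds

    image-sum : sum (image ps f≥2) ≡ n
    image-sum = trans (sum-↭ (sort-↭ qs)) (trans (sum-replaceK ps w) sum≡n)

    s∈image : s ∈ image ps f≥2
    s∈image = ∈-resp-↭ (↭-sym (sort-↭ qs)) (s∈replaceK ps w (≤-trans (s≤s z≤n) f≥2))

    no-k : mult k (image ps f≥2) ≡ 0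
    no-k = trans (mult-image ps f≥2 k) (mult-k-replaceK ps w)

    many-s : 2 * r ∸ 4 ≤ mult s (image ps f≥2)
    many-s = ≤-trans (quot-lower ps w r rs≤k f≥2)
      (≤-reflexive (sym (trans (mult-image ps f≥2 s) (mult-s-replaceK ps w (no-part-s bounds)))))

  φ₄ : ∀ {n} → C4 L s k n → F4 L s k r n
  φ₄ (ps , c) = image ps (proj₂ c) , image-in-F4 c

  φ₄-injective : ∀ {n} → InjectivePartitionMap (φ₄ {n})
  φ₄-injective (ps₁ , ((sorted₁ , _) , bounds₁) , f₁≥2) (ps₂ , ((sorted₂ , _) , bounds₂) , f₂≥2) same-image =
    sorted-mult-unique ps₁ ps₂ sorted₁ sorted₂
      (replaceK-reflects-mult ps₁ ps₂ (windowOf ps₁ f₁≥2) (windowOf ps₂ f₂≥2) (no-part-s bounds₁) (no-part-s bounds₂)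
        (λ j → trans (sym (mult-image ps₁ f₁≥2 j)) (trans (cong (mult j) same-image) (mult-image ps₂ f₂≥2 j))))

double-below-bound : ∀ {s} → 1 ≤ s → s + s < 2 * s * s * s + 5 * s * s + 1
double-below-bound {s} s≥1 = begin-strict
  s + s                         ≤⟨ +-monoʳ-≤ s (m≤m+n s (3 * s)) ⟩
  5 * s                         ≤⟨ m≤m*n (5 * s) s {{>-nonZero s≥1}} ⟩
  5 * s * s                     ≤⟨ m≤n+m (5 * s * s) (2 * s * s * s) ⟩
  2 * s * s * s + 5 * s * s     <⟨ m<m+n _ 0<1+n ⟩
  2 * s * s * s + 5 * s * s + 1 ∎
  where open ≤-Reasoning

lemma2p6 : (s L k n r t : ℕ) → 1 ≤ s →
    2 * s * s * s + 5 * s * s + 1 ≤ L →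
    L ≤ k → k ≤ s + L →
    2 * s * s * s * s * s + 8 * s * s * s * s + s * s * s + 3 * s + 1 ≤ n + 14 * s * s →
    k ≡ r * s + t → t < s →
    Σ (C4 L s k n → F4 L s k r n) InjectivePartitionMap
lemma2p6 s L k n r t s≥1 L-large L≤k _ _ k≡rs+t _ = φ₄ , φ₄-injective
  where
  2s<L : s + s < L
  2s<L = <-≤-trans (double-below-bound s≥1) L-large

  rs≤k : r * s ≤ k
  rs≤k = ≤-trans (m≤m+n (r * s) t) (≤-reflexive (sym k≡rs+t))

  open Injection L s k r s≥1 2s<L L≤k rs≤k
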